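{- Let $d\ge 2$. For integers $m$ and $k$ let $a_{m,k}^{(d)}$ denote the number of generalized linear diagrams with $m$ blocks of size $d$ having exactly $k$ loops, with the conventions $a_{0,0}^{(d)}=1$ and $a_{m,k}^{(d)}=0$ whenever $m<0$, $k<0$, or $k>m(d-1)$. Then for every $n>0$ and every $0\le k\le n(d-1)$, $$ a_{n,k}^{(d)}=\sum_{t=k-d+1}^{k+d-1} c_{n,k,t}^{(d)}\, a_{n-1,t}^{(d)},\qquad c_{n,k,t}^{(d)}=\sum_{i=0}^{d-1}\binom{d-1}{i}\binom{t}{t+i-k}\binom{d(n-1)-t}{d-2i-t+k-1}. $$
   Context: A generalized linear diagram with $m$ blocks of size $d$ is a partition of the set $\{1,2,\ldots,md\}$ (points on a line) into $m$ unordered blocks, each of size $d$. A loop is a pair of consecutive points $\{i,i+1\}$, $1\le i<md$, lying in the same block. Binomial coefficients $\binom{a}{b}$ are taken to be $0$ unless $0\le b\le a$. -}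

module Defs where

open import Data.Bool using (Bool; true; false; if_then_else_; _∧_)
open import Data.Nat using (ℕ; zero; suc; _+_; _*_; _∸_; _≤ᵇ_; _⊔_; _≡ᵇ_)
open import Data.Nat.Combinatorics using (_C_)
open import Data.Fin using (Fin; toℕ)
open import Data.List using (List; []; _∷_; map; concatMap; length; filterᵇ; allFin; upTo)
open import Data.Nat.ListAction using (sum)
open import Data.Integer using (ℤ; +_; -[1+_]; _-_)

allWords : (m len : ℕ) → List (List (Fin m))
allWords m zero = [] ∷ []
allWords m (suc len) = concatMap (λ x → map (x ∷_) (allWords m len)) (allFin m)

occ : {m : ℕ} → Fin m → List (Fin m) → ℕ
occ j [] = 0
occ j (x ∷ xs) = (if toℕ x ≡ᵇ toℕ j then 1 else 0) + occ j xs

-- Restricted growth: labels appear in order of first occurrence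
-- (c = number of labels already used).  This picks the unique canonical
-- labelling of each set partition (blocks unordered).
rgAux : {m : ℕ} → ℕ → List (Fin m) → Bool
rgAux c [] = true
rgAux c (x ∷ xs) = (toℕ x ≤ᵇ c) ∧ rgAux (c ⊔ suc (toℕ x)) xs

allb : {A : Set} → (A → Bool) → List A → Bool
allb p [] = true
allb p (x ∷ xs) = p x ∧ allb p xs

-- A word w : positions 1..md ↦ block label, is a (canonical code of a)
-- generalized linear diagram with m blocks of size d.
isDiagram : (m d : ℕ) → List (Fin m) → Bool
isDiagram m d w = rgAux 0 w ∧ allb (λ j → occ j w ≡ᵇ d) (allFin m)

-- Number of loops: consecutive points lying in the same block.
loops : {m : ℕ} → List (Fin m) → ℕ
loops [] = 0
loops (x ∷ []) = 0
loops (x ∷ y ∷ rest) = (if toℕ x ≡ᵇ toℕ y then 1 else 0) + loops (y ∷ rest)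

aN : (d m k : ℕ) → ℕ
aN d m k = length (filterᵇ (λ w → isDiagram m d w ∧ (loops w ≡ᵇ k)) (allWords m (m * d)))

-- Integer-indexed version with the convention a_{m,k} = 0 for m<0 or k<0.
-- (a_{0,0} = 1 and a_{m,k} = 0 for k > m(d-1) hold automatically for aN.)
aZ : (d : ℕ) → ℤ → ℤ → ℕ
aZ d (+ m) (+ k) = aN d m k
aZ d (+ m) -[1+ k ] = 0
aZ d -[1+ m ] k = 0

binomZ : ℤ → ℤ → ℕ
binomZ (+ a) (+ b) = a C b   -- stdlib: a C b = 0 when b > a
binomZ (+ a) -[1+ b ] = 0
binomZ -[1+ a ] b = 0

Σ< : ℕ → (ℕ → ℕ) → ℕ
Σ< n f = sum (map f (upTo n))

coef : (d n k : ℕ) → ℤ → ℕ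
coef d n k t = Σ< d (λ i →
  ((d ∸ 1) C i)
  * binomZ t ((t Data.Integer.+ + i) - + k)
  * binomZ (+ (d * (n ∸ 1)) - t)
           ((((+ d - + (2 * i)) - t) Data.Integer.+ + k) - + 1))

-- Right-hand side: Σ_{t=k-d+1}^{k+d-1} c_{n,k,t} a_{n-1,t}
-- (t = k-d+1+j for j = 0 .. 2d-2)
rhs : (d n k : ℕ) → ℕ
rhs d n k = Σ< (2 * d ∸ 1) (λ j →
  let t = (+ k - + (d ∸ 1)) Data.Integer.+ + j in
  coef d n k t * aZ d (+ n - + 1) t)

module Submission where

-- Let block 0 be the block of point 1. Deleting it from a diagram with n blocks leaves a
-- diagram w with n − 1 blocks on d(n − 1) points, and the diagram is recovered from w and the
-- positions of the d − 1 further points of block 0. Each gap after a letter of w is a loop gap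
-- (t = loops w of them) or an open gap (d(n − 1) − t of them). If the further points of block 0
-- occupy a open and b loop gaps and i of them directly follow a point of block 0, then
-- a + b + i = d − 1, there are C(d − 1, i) C(t, b) C(d(n − 1) − t, a) such placements, and the
-- new diagram has t − b + i loops. Solving for a and b gives c_{n,k,t}, which vanishes unless
-- |k − t| < d; grouping the words w by t gives the recurrence.

open import Defs
open import Data.Nat using (ℕ; zero; suc; _+_; _*_; _∸_; _≤_; _<_; _≡ᵇ_; _≤ᵇ_; _<ᵇ_; _⊔_; _≤?_; _≟_; s≤s; pred)
open import Data.Nat.Properties
open import Data.Nat.Combinatorics using (_C_; nCk+nC[k+1]≡[n+1]C[k+1]; nCk≡nC[n∸k]; k>n⇒nCk≡0)
open import Data.Nat.ListAction using (sum)
open import Data.Nat.ListAction.Properties using (sum-++)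
open import Data.Nat.Tactic.RingSolver using (solve-∀; solve)
open import Data.Bool using (Bool; true; false; not; if_then_else_; _∧_; T)
open import Data.Bool.Properties using (∧-assoc; ∧-commutativeMonoid)
open import Algebra.Bundles using (CommutativeMonoid)
open import Data.Fin using (Fin; toℕ) renaming (zero to fzero; suc to fsuc)
open import Data.List using (List; []; _∷_; map; concatMap; length; filterᵇ; allFin; upTo; _++_)
open import Data.List.Properties using (map-cong; map-cong-local; map-∘; map-++; map-applyUpTo; map-upTo; map-tabulate)
open import Data.List.Relation.Unary.All as All using (All)
open import Data.List.Relation.Unary.All.Properties using (all-upTo; map⁺; ++⁺; concat⁺; tabulate⁺)
open import Data.Product using (_×_; _,_; proj₁; proj₂; uncurry; ∃)
import Data.Integer as Int
open Int using (ℤ; -[1+_]; _⊖_)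
open import Data.Integer.Properties using ([+m]-[+n]≡m⊖n; ⊖-≥; ⊖-≰)
import Data.Integer.Tactic.RingSolver as ZR
open import Data.Empty using (⊥-elim)
open import Data.Unit using (tt)
open import Function using (_∘_; id)
open import Relation.Nullary using (Dec; yes; no; ¬_)
open import Relation.Nullary.Decidable using (_×-dec_)
open import Relation.Binary.PropositionalEquality
open import Algebra.Properties.CommutativeSemigroup +-commutativeSemigroup using () renaming (interchange to +-interchange)
open import Algebra.Properties.CommutativeSemigroup *-commutativeSemigroup using () renaming (x∙yz≈y∙xz to *-left-comm)
open import Algebra.Properties.CommutativeSemigroup (CommutativeMonoid.commutativeSemigroup ∧-commutativeMonoid)
  using () renaming (x∙yz≈y∙xz to ∧-left-comm)
open ≡-Reasoning

∑ : {A : Set} → List A → (A → ℕ) → ℕ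
∑ xs f = sum (map f xs)

private variable A B : Set

∑-cong : ∀ (xs : List A) {f g : A → ℕ} → (∀ x → f x ≡ g x) → ∑ xs f ≡ ∑ xs g
∑-cong xs f≗g = cong sum (map-cong f≗g xs)

∑-cong-All : ∀ {P : A → Set} {xs} {f g : A → ℕ} → All P xs → (∀ x → P x → f x ≡ g x) → ∑ xs f ≡ ∑ xs g
∑-cong-All pxs f≗g = cong sum (map-cong-local (All.map (λ {x} → f≗g x) pxs))

∑-zero : ∀ (xs : List A) {f : A → ℕ} → (∀ x → f x ≡ 0) → ∑ xs f ≡ 0
∑-zero [] f≗0 = refl
∑-zero (x ∷ xs) f≗0 = cong₂ _+_ (f≗0 x) (∑-zero xs f≗0)

∑-zero-All : ∀ {P : A → Set} {xs} {f : A → ℕ} → All P xs → (∀ x → P x → f x ≡ 0) → ∑ xs f ≡ 0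
∑-zero-All {xs = xs} pxs f≡0 = trans (∑-cong-All pxs f≡0) (∑-zero xs λ _ → refl)

∑-+ : ∀ (xs : List A) (f g : A → ℕ) → ∑ xs (λ x → f x + g x) ≡ ∑ xs f + ∑ xs g
∑-+ [] f g = refl
∑-+ (x ∷ xs) f g = begin
  f x + g x + ∑ xs (λ x → f x + g x) ≡⟨ cong (f x + g x +_) (∑-+ xs f g) ⟩
  f x + g x + (∑ xs f + ∑ xs g)      ≡⟨ +-interchange (f x) (g x) _ _ ⟩
  f x + ∑ xs f + (g x + ∑ xs g)      ∎

∑-*ˡ : ∀ (xs : List A) c (f : A → ℕ) → ∑ xs (λ x → c * f x) ≡ c * ∑ xs f
∑-*ˡ [] c f = sym (*-zeroʳ c)
∑-*ˡ (x ∷ xs) c f = trans (cong (c * f x +_) (∑-*ˡ xs c f)) (sym (*-distribˡ-+ c (f x) _))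

∑-++ : ∀ (xs ys : List A) (f : A → ℕ) → ∑ (xs ++ ys) f ≡ ∑ xs f + ∑ ys f
∑-++ xs ys f = trans (cong sum (map-++ f xs ys)) (sum-++ (map f xs) (map f ys))

∑-map : (h : B → A) (ys : List B) (f : A → ℕ) → ∑ (map h ys) f ≡ ∑ ys (f ∘ h)
∑-map h ys f = cong sum (sym (map-∘ {g = f} {f = h} ys))

∑-concatMap : (g : B → List A) (ys : List B) (f : A → ℕ) →
  ∑ (concatMap g ys) f ≡ ∑ ys (λ y → ∑ (g y) f)
∑-concatMap g [] f = refl
∑-concatMap g (y ∷ ys) f = trans (∑-++ (g y) (concatMap g ys) f) (cong (∑ (g y) f +_) (∑-concatMap g ys f))

∑-comm : (xs : List A) (ys : List B) (h : A → B → ℕ) →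
  ∑ xs (λ x → ∑ ys (h x)) ≡ ∑ ys (λ y → ∑ xs (λ x → h x y))
∑-comm [] ys h = sym (∑-zero ys (λ _ → refl))
∑-comm (x ∷ xs) ys h = trans (cong (∑ ys (h x) +_) (∑-comm xs ys h)) (sym (∑-+ ys (h x) _))

𝟙 : Bool → ℕ
𝟙 b = if b then 1 else 0

𝟙-∧ : ∀ x y → 𝟙 (x ∧ y) ≡ 𝟙 x * 𝟙 y
𝟙-∧ true y = sym (+-identityʳ (𝟙 y))
𝟙-∧ false y = refl

length-filterᵇ : ∀ (p : A → Bool) xs → length (filterᵇ p xs) ≡ ∑ xs (𝟙 ∘ p)
length-filterᵇ p [] = refl
length-filterᵇ p (x ∷ xs) with p x
... | true = cong suc (length-filterᵇ p xs)
... | false = length-filterᵇ p xs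

δ : ℕ → ℕ → ℕ
δ x y = 𝟙 (x ≡ᵇ y)

δ-≡ : ∀ {x y} → x ≡ y → δ x y ≡ 1
δ-≡ {x} refl with x ≡ᵇ x in eq
... | true = refl
... | false = ⊥-elim (subst T eq (≡⇒≡ᵇ x x refl))

δ-≢ : ∀ {x y} → x ≢ y → δ x y ≡ 0
δ-≢ {x} {y} x≢y with x ≡ᵇ y in eq
... | true = ⊥-elim (x≢y (≡ᵇ⇒≡ x y (subst T (sym eq) tt)))
... | false = refl

δ-sym : ∀ x y → δ x y ≡ δ y x
δ-sym zero zero = refl
δ-sym zero (suc y) = refl
δ-sym (suc x) zero = refl
δ-sym (suc x) (suc y) = δ-sym x y

δ-congˡ : ∀ {x x′} y → x ≡ x′ → δ x y ≡ δ x′ y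
δ-congˡ y = cong (λ x → δ x y)

δ-congʳ : ∀ x {y y′} → y ≡ y′ → δ x y ≡ δ x y′
δ-congʳ x = cong (δ x)

δ*δ-≡ : ∀ {x₁ y₁ x₂ y₂} → x₁ ≡ y₁ → x₂ ≡ y₂ → δ x₁ y₁ * δ x₂ y₂ ≡ 1
δ*δ-≡ p q rewrite δ-≡ p | δ-≡ q = refl

δ*δ-≢ : ∀ {x₁ y₁ x₂ y₂} → ¬ (x₁ ≡ y₁ × x₂ ≡ y₂) → δ x₁ y₁ * δ x₂ y₂ ≡ 0
δ*δ-≢ {x₁} {y₁} {x₂} {y₂} ¬both with x₁ ≟ y₁ | x₂ ≟ y₂
... | yes p | yes q = ⊥-elim (¬both (p , q))
... | yes _ | no q = trans (cong (δ x₁ y₁ *_) (δ-≢ q)) (*-zeroʳ (δ x₁ y₁))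
... | no p | _ = cong (_* δ x₂ y₂) (δ-≢ p)

δ*δ-cong : ∀ {x₁ y₁ x₂ y₂ x₃ y₃ x₄ y₄} →
  (x₁ ≡ y₁ → x₂ ≡ y₂ → x₃ ≡ y₃ × x₄ ≡ y₄) → (x₃ ≡ y₃ → x₄ ≡ y₄ → x₁ ≡ y₁ × x₂ ≡ y₂) →
  δ x₁ y₁ * δ x₂ y₂ ≡ δ x₃ y₃ * δ x₄ y₄
δ*δ-cong {x₁} {y₁} {x₂} {y₂} ⇒ ⇐ with (x₁ ≟ y₁) ×-dec (x₂ ≟ y₂)
... | yes (p , q) = trans (δ*δ-≡ p q) (sym (uncurry δ*δ-≡ (⇒ p q)))
... | no ¬pq = trans (δ*δ-≢ ¬pq) (sym (δ*δ-≢ λ (r , t) → ¬pq (⇐ r t)))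

m+n≡o⇒n≡o∸m : ∀ m {n o} → m + n ≡ o → n ≡ o ∸ m
m+n≡o⇒n≡o∸m m refl = sym (m+n∸m≡n m _)

m+n≡o⇒m≡o∸n : ∀ {m} n {o} → m + n ≡ o → m ≡ o ∸ n
m+n≡o⇒m≡o∸n n refl = sym (m+n∸n≡m _ n)

Σ<-suc : ∀ n (f : ℕ → ℕ) → Σ< (suc n) f ≡ f 0 + Σ< n (f ∘ suc)
Σ<-suc n f = cong (λ xs → f 0 + sum xs) (trans (map-applyUpTo suc f n) (sym (map-upTo (f ∘ suc) n)))

Σ<-zero : ∀ n {f : ℕ → ℕ} → (∀ i → i < n → f i ≡ 0) → Σ< n f ≡ 0
Σ<-zero n = ∑-zero-All (all-upTo n)

Σ<-single : ∀ n (g : ℕ → ℕ) {i₀} → i₀ < n → (∀ i → i ≢ i₀ → g i ≡ 0) → Σ< n g ≡ g i₀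
Σ<-single (suc n) g {zero} _ g≡0 = begin
  Σ< (suc n) g            ≡⟨ Σ<-suc n g ⟩
  g 0 + Σ< n (g ∘ suc)    ≡⟨ cong (g 0 +_) (∑-zero (upTo n) (λ i → g≡0 (suc i) λ ())) ⟩
  g 0 + 0                 ≡⟨ +-identityʳ (g 0) ⟩
  g 0                     ∎
Σ<-single (suc n) g {suc i₀} (s≤s i₀<n) g≡0 = begin
  Σ< (suc n) g            ≡⟨ Σ<-suc n g ⟩
  g 0 + Σ< n (g ∘ suc)    ≡⟨ cong₂ _+_ (g≡0 0 λ ()) (Σ<-single n (g ∘ suc) i₀<n λ i i≢i₀ →
                                                        g≡0 (suc i) (i≢i₀ ∘ suc-injective)) ⟩
  g (suc i₀)              ∎

C-as-Σ<-complement : ∀ s j → s C j ≡ Σ< (suc s) (λ i → (s C i) * δ (j + i) s)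
C-as-Σ<-complement s j with j ≤? s
... | yes j≤s = sym (begin
  Σ< (suc s) (λ i → (s C i) * δ (j + i) s) ≡⟨ Σ<-single (suc s) _ (s≤s (m∸n≤m s j)) off-complement ⟩
  (s C (s ∸ j)) * δ (j + (s ∸ j)) s        ≡⟨ cong ((s C (s ∸ j)) *_) (δ-≡ (m+[n∸m]≡n j≤s)) ⟩
  (s C (s ∸ j)) * 1                        ≡⟨ *-identityʳ _ ⟩
  s C (s ∸ j)                              ≡⟨ sym (nCk≡nC[n∸k] j≤s) ⟩
  s C j                                    ∎)
  where
  off-complement : ∀ i → i ≢ s ∸ j → (s C i) * δ (j + i) s ≡ 0
  off-complement i i≢ = trans (cong ((s C i) *_) (δ-≢ λ j+i≡s → i≢ (m+n≡o⇒n≡o∸m j j+i≡s))) (*-zeroʳ (s C i))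
... | no j≰s = trans (k>n⇒nCk≡0 (≰⇒> j≰s)) (sym (Σ<-zero (suc s) λ i _ →
  trans (cong ((s C i) *_) (δ-≢ λ j+i≡s → j≰s (subst (j ≤_) j+i≡s (m≤m+n j i)))) (*-zeroʳ (s C i))))

subsetSizes : ℕ → List ℕ
subsetSizes zero = 0 ∷ []
subsetSizes (suc p) = subsetSizes p ++ map suc (subsetSizes p)

∑-subsetSizes-suc : ∀ p (f : ℕ → ℕ) → ∑ (subsetSizes (suc p)) f ≡ ∑ (subsetSizes p) f + ∑ (subsetSizes p) (f ∘ suc)
∑-subsetSizes-suc p f = trans (∑-++ (subsetSizes p) _ f) (cong (∑ (subsetSizes p) f +_) (∑-map suc (subsetSizes p) f))

∑-subsetSizes-size : ∀ p A (f : ℕ → ℕ) → ∑ (subsetSizes p) (λ a → δ a A * f a) ≡ (p C A) * f A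
∑-subsetSizes-size zero zero f = +-identityʳ _
∑-subsetSizes-size zero (suc A) f = refl
∑-subsetSizes-size (suc p) zero f = begin
  ∑ (subsetSizes (suc p)) (λ a → δ a 0 * f a)
    ≡⟨ ∑-subsetSizes-suc p _ ⟩
  ∑ (subsetSizes p) (λ a → δ a 0 * f a) + ∑ (subsetSizes p) (λ a → 0)
    ≡⟨ cong₂ _+_ (∑-subsetSizes-size p 0 f) (∑-zero (subsetSizes p) (λ _ → refl)) ⟩
  (p C 0) * f 0 + 0
    ≡⟨ +-identityʳ _ ⟩
  (suc p C 0) * f 0
    ∎
∑-subsetSizes-size (suc p) (suc A) f = begin
  ∑ (subsetSizes (suc p)) (λ a → δ a (suc A) * f a)
    ≡⟨ ∑-subsetSizes-suc p _ ⟩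
  ∑ (subsetSizes p) (λ a → δ a (suc A) * f a) + ∑ (subsetSizes p) (λ a → δ a A * f (suc a))
    ≡⟨ cong₂ _+_ (∑-subsetSizes-size p (suc A) f) (∑-subsetSizes-size p A (f ∘ suc)) ⟩
  (p C suc A) * f (suc A) + (p C A) * f (suc A)
    ≡⟨ sym (*-distribʳ-+ (f (suc A)) (p C suc A) (p C A)) ⟩
  (p C suc A + p C A) * f (suc A)
    ≡⟨ cong (_* f (suc A)) (trans (+-comm (p C suc A) (p C A)) (nCk+nC[k+1]≡[n+1]C[k+1] p A)) ⟩
  (suc p C suc A) * f (suc A)
    ∎

compositions : ℕ → ℕ → ℕ
compositions zero zero = 1
compositions zero (suc j) = 0
compositions (suc s) zero = 0
compositions (suc s) (suc j) = s C j

suc-C≡C+compositions : ∀ s j → suc s C j ≡ s C j + compositions (suc s) j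
suc-C≡C+compositions s zero = refl
suc-C≡C+compositions s (suc j) = trans (sym (nCk+nC[k+1]≡[n+1]C[k+1] s j)) (+-comm (s C j) (s C suc j))

compositions-zero : ∀ j → compositions 0 j ≡ 0 C j
compositions-zero zero = refl
compositions-zero (suc j) = refl

∑⊆² : ℕ → ℕ → (ℕ → ℕ → ℕ) → ℕ
∑⊆² P L h = ∑ (subsetSizes P) λ a → ∑ (subsetSizes L) (h a)

∑⊆²-cong : ∀ P L {h h′ : ℕ → ℕ → ℕ} → (∀ a b → h a b ≡ h′ a b) → ∑⊆² P L h ≡ ∑⊆² P L h′
∑⊆²-cong P L h≗h′ = ∑-cong (subsetSizes P) λ a → ∑-cong (subsetSizes L) (h≗h′ a)

∑⊆²-+ : ∀ P L (h h′ : ℕ → ℕ → ℕ) → ∑⊆² P L (λ a b → h a b + h′ a b) ≡ ∑⊆² P L h + ∑⊆² P L h′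
∑⊆²-+ P L h h′ = trans (∑-cong (subsetSizes P) λ a → ∑-+ (subsetSizes L) (h a) (h′ a)) (∑-+ (subsetSizes P) _ _)

∑⊆²-zero : ∀ P L {h : ℕ → ℕ → ℕ} → (∀ a b → h a b ≡ 0) → ∑⊆² P L h ≡ 0
∑⊆²-zero P L h≗0 = ∑-zero (subsetSizes P) λ a → ∑-zero (subsetSizes L) (h≗0 a)

∑⊆²-sucˡ : ∀ P L (h : ℕ → ℕ → ℕ) → ∑⊆² (suc P) L h ≡ ∑⊆² P L h + ∑⊆² P L (h ∘ suc)
∑⊆²-sucˡ P L h = ∑-subsetSizes-suc P _

∑⊆²-sucʳ : ∀ P L (h : ℕ → ℕ → ℕ) → ∑⊆² P (suc L) h ≡ ∑⊆² P L h + ∑⊆² P L (λ a b → h a (suc b))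
∑⊆²-sucʳ P L h = trans (∑-cong (subsetSizes P) λ a → ∑-subsetSizes-suc L (h a)) (∑-+ (subsetSizes P) _ _)

∑⊆²-∑ : ∀ {C : Set} P L (xs : List C) (h : ℕ → ℕ → C → ℕ) →
  ∑⊆² P L (λ a b → ∑ xs (h a b)) ≡ ∑ xs (λ i → ∑⊆² P L (λ a b → h a b i))
∑⊆²-∑ P L xs h = trans (∑-cong (subsetSizes P) λ a → ∑-comm (subsetSizes L) xs (h a)) (∑-comm (subsetSizes P) xs _)

∑⊆²-*ˡ : ∀ P L c (h : ℕ → ℕ → ℕ) → ∑⊆² P L (λ a b → c * h a b) ≡ c * ∑⊆² P L h
∑⊆²-*ˡ P L c h = trans (∑-cong (subsetSizes P) λ a → ∑-*ˡ (subsetSizes L) c (h a)) (∑-*ˡ (subsetSizes P) c _)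

∑⊆²-δδ : ∀ P L A B → ∑⊆² P L (λ a b → δ a A * δ b B) ≡ (P C A) * (L C B)
∑⊆²-δδ P L A B = begin
  ∑ (subsetSizes P) (λ a → ∑ (subsetSizes L) (λ b → δ a A * δ b B))
    ≡⟨ ∑-cong (subsetSizes P) (λ a → ∑-*ˡ (subsetSizes L) (δ a A) (λ b → δ b B)) ⟩
  ∑ (subsetSizes P) (λ a → δ a A * ∑ (subsetSizes L) (λ b → δ b B))
    ≡⟨ ∑-subsetSizes-size P A _ ⟩
  (P C A) * ∑ (subsetSizes L) (λ b → δ b B)
    ≡⟨ cong ((P C A) *_) (trans (∑-cong (subsetSizes L) λ b → sym (*-identityʳ (δ b B))) (∑-subsetSizes-size L B (λ _ → 1))) ⟩
  (P C A) * ((L C B) * 1)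
    ≡⟨ cong ((P C A) *_) (*-identityʳ (L C B)) ⟩
  (P C A) * (L C B)
    ∎

allMasks : ℕ → List (List Bool)
allMasks zero = [] ∷ []
allMasks (suc L) = map (true ∷_) (allMasks L) ++ map (false ∷_) (allMasks L)

∑-allMasks-suc : ∀ L (f : List Bool → ℕ) →
  ∑ (allMasks (suc L)) f ≡ ∑ (allMasks L) (f ∘ (true ∷_)) + ∑ (allMasks L) (f ∘ (false ∷_))
∑-allMasks-suc L f = trans (∑-++ (map (true ∷_) (allMasks L)) (map (false ∷_) (allMasks L)) f)
  (cong₂ _+_ (∑-map (true ∷_) (allMasks L) f) (∑-map (false ∷_) (allMasks L) f))

allMasks-length : ∀ L → All (λ b → length b ≡ L) (allMasks L)
allMasks-length zero = refl All.∷ All.[]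
allMasks-length (suc L) = ++⁺ (map⁺ extended) (map⁺ extended)
  where
  extended : All (λ b → suc (length b) ≡ suc L) (allMasks L)
  extended = All.map (cong suc) (allMasks-length L)

∑-allFin-suc : ∀ m (f : Fin (suc m) → ℕ) → ∑ (allFin (suc m)) f ≡ f fzero + ∑ (allFin m) (f ∘ fsuc)
∑-allFin-suc m f = cong (λ xs → f fzero + sum xs) (trans (map-tabulate fsuc f) (sym (map-tabulate id (f ∘ fsuc))))

∑-allWords-suc : ∀ m L (f : List (Fin m) → ℕ) →
  ∑ (allWords m (suc L)) f ≡ ∑ (allFin m) (λ x → ∑ (allWords m L) (f ∘ (x ∷_)))
∑-allWords-suc m L f = trans (∑-concatMap _ (allFin m) f) (∑-cong (allFin m) λ x → ∑-map (x ∷_) (allWords m L) f)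

allWords-length : ∀ m L → All (λ w → length w ≡ L) (allWords m L)
allWords-length m zero = refl All.∷ All.[]
allWords-length m (suc L) =
  concat⁺ (map⁺ {f = λ x → map (x ∷_) (allWords m L)} (tabulate⁺ {f = id} λ _ → map⁺ (All.map (cong suc) (allWords-length m L))))

trues falses : List Bool → ℕ
trues [] = 0
trues (true ∷ b) = suc (trues b)
trues (false ∷ b) = trues b
falses [] = 0
falses (true ∷ b) = falses b
falses (false ∷ b) = suc (falses b)

trues+falses≡length : ∀ b → trues b + falses b ≡ length b
trues+falses≡length [] = refl
trues+falses≡length (true ∷ b) = cong suc (trues+falses≡length b)
trues+falses≡length (false ∷ b) = trans (+-suc (trues b) (falses b)) (cong suc (trues+falses≡length b))

insertBlock : ∀ {m} → List Bool → List (Fin m) → List (Fin (suc m))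
insertBlock [] w = []
insertBlock (true ∷ b) w = fzero ∷ insertBlock b w
insertBlock (false ∷ b) [] = []
insertBlock (false ∷ b) (y ∷ w) = fsuc y ∷ insertBlock b w

∑-allWords-by-block₀ : ∀ m L (f : List (Fin (suc m)) → ℕ) →
  ∑ (allWords (suc m) L) f ≡ ∑ (allMasks L) (λ b → ∑ (allWords m (falses b)) (f ∘ insertBlock b))
∑-allWords-by-block₀ m zero f = sym (+-identityʳ _)
∑-allWords-by-block₀ m (suc L) f = begin
  ∑ (allWords (suc m) (suc L)) f
    ≡⟨ ∑-allWords-suc (suc m) L f ⟩
  ∑ (allFin (suc m)) (λ x → ∑ (allWords (suc m) L) (f ∘ (x ∷_)))
    ≡⟨ ∑-allFin-suc m _ ⟩
  ∑ (allWords (suc m) L) (f ∘ (fzero ∷_)) + ∑ (allFin m) (λ y → ∑ (allWords (suc m) L) (f ∘ (fsuc y ∷_)))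
    ≡⟨ cong₂ _+_ (∑-allWords-by-block₀ m L _)
                 (trans (∑-cong (allFin m) λ y → ∑-allWords-by-block₀ m L _) (∑-comm (allFin m) (allMasks L) _)) ⟩
  ∑ (allMasks L) (λ b → ∑ (allWords m (falses b)) (f ∘ insertBlock (true ∷ b)))
    + ∑ (allMasks L) (λ b → ∑ (allFin m) (λ y → ∑ (allWords m (falses b)) (λ w → f (fsuc y ∷ insertBlock b w))))
    ≡⟨ cong (∑ (allMasks L) (λ b → ∑ (allWords m (falses b)) (f ∘ insertBlock (true ∷ b))) +_)
            (∑-cong (allMasks L) λ b → sym (∑-allWords-suc m (falses b) _)) ⟩
  ∑ (allMasks L) (λ b → ∑ (allWords m (falses b)) (f ∘ insertBlock (true ∷ b)))
    + ∑ (allMasks L) (λ b → ∑ (allWords m (suc (falses b))) (f ∘ insertBlock (false ∷ b)))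
    ≡⟨ sym (∑-allMasks-suc L _) ⟩
  ∑ (allMasks (suc L)) (λ b → ∑ (allWords m (falses b)) (f ∘ insertBlock b))
    ∎

<ᵇ-suc : ∀ x c → (x <ᵇ suc c) ≡ (x ≤ᵇ c)
<ᵇ-suc zero c = refl
<ᵇ-suc (suc x) c = refl

module _ {m : ℕ} where

  rgAux-insertBlock : ∀ c b (w : List (Fin m)) → length w ≡ falses b → rgAux (suc c) (insertBlock b w) ≡ rgAux c w
  rgAux-insertBlock c [] [] _ = refl
  rgAux-insertBlock c (true ∷ b) w lw rewrite ⊔-identityʳ c = rgAux-insertBlock c b w lw
  rgAux-insertBlock c (false ∷ b) (y ∷ w) lw rewrite <ᵇ-suc (toℕ y) c =
    cong ((toℕ y ≤ᵇ c) ∧_) (rgAux-insertBlock (c ⊔ suc (toℕ y)) b w (suc-injective lw))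

  occ-fzero-insertBlock : ∀ b (w : List (Fin m)) → length w ≡ falses b → occ fzero (insertBlock b w) ≡ trues b
  occ-fzero-insertBlock [] [] _ = refl
  occ-fzero-insertBlock (true ∷ b) w lw = cong suc (occ-fzero-insertBlock b w lw)
  occ-fzero-insertBlock (false ∷ b) (y ∷ w) lw = occ-fzero-insertBlock b w (suc-injective lw)

  occ-fsuc-insertBlock : ∀ j b (w : List (Fin m)) → length w ≡ falses b → occ (fsuc j) (insertBlock b w) ≡ occ j w
  occ-fsuc-insertBlock j [] [] _ = refl
  occ-fsuc-insertBlock j (true ∷ b) w lw = occ-fsuc-insertBlock j b w lw
  occ-fsuc-insertBlock j (false ∷ b) (y ∷ w) lw = cong (δ (toℕ y) (toℕ j) +_) (occ-fsuc-insertBlock j b w (suc-injective lw))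

allb-cong : ∀ {p q : A → Bool} xs → (∀ x → p x ≡ q x) → allb p xs ≡ allb q xs
allb-cong [] p≗q = refl
allb-cong (x ∷ xs) p≗q = cong₂ _∧_ (p≗q x) (allb-cong xs p≗q)

allb-map : ∀ (p : A → Bool) (f : B → A) xs → allb p (map f xs) ≡ allb (p ∘ f) xs
allb-map p f [] = refl
allb-map p f (x ∷ xs) = cong (p (f x) ∧_) (allb-map p f xs)

allb-allFin-suc : ∀ m (p : Fin (suc m) → Bool) → allb p (allFin (suc m)) ≡ p fzero ∧ allb (p ∘ fsuc) (allFin m)
allb-allFin-suc m p = cong (p fzero ∧_) (trans (cong (allb p) (sym (map-tabulate id fsuc))) (allb-map p fsuc (allFin m)))

isDiagram-insertBlock : ∀ m d b (w : List (Fin m)) → length w ≡ falses b →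
  isDiagram (suc m) d (fzero ∷ insertBlock b w) ≡ (suc (trues b) ≡ᵇ d) ∧ isDiagram m d w
isDiagram-insertBlock m d b w lw = begin
  rgAux 1 (insertBlock b w) ∧ allb (λ j → occ j (fzero ∷ insertBlock b w) ≡ᵇ d) (allFin (suc m))
    ≡⟨ cong₂ _∧_ (rgAux-insertBlock 0 b w lw) (allb-allFin-suc m _) ⟩
  rgAux 0 w ∧ ((suc (occ fzero (insertBlock b w)) ≡ᵇ d) ∧ allb (λ j → occ (fsuc j) (insertBlock b w) ≡ᵇ d) (allFin m))
    ≡⟨ cong (rgAux 0 w ∧_) (cong₂ _∧_ (cong (λ n → suc n ≡ᵇ d) (occ-fzero-insertBlock b w lw))
                                       (allb-cong (allFin m) λ j → cong (_≡ᵇ d) (occ-fsuc-insertBlock j b w lw))) ⟩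
  rgAux 0 w ∧ ((suc (trues b) ≡ᵇ d) ∧ allb (λ j → occ j w ≡ᵇ d) (allFin m))
    ≡⟨ ∧-left-comm (rgAux 0 w) (suc (trues b) ≡ᵇ d) _ ⟩
  (suc (trues b) ≡ᵇ d) ∧ isDiagram m d w
    ∎

shuffles : ℕ → ℕ → List (List Bool)
shuffles zero zero = [] ∷ []
shuffles zero (suc s) = map (true ∷_) (shuffles zero s)
shuffles (suc n) zero = map (false ∷_) (shuffles n zero)
shuffles (suc n) (suc s) = map (true ∷_) (shuffles (suc n) s) ++ map (false ∷_) (shuffles n (suc s))

∑-shuffles-suc-suc : ∀ n s (g : List Bool → ℕ) →
  ∑ (shuffles (suc n) (suc s)) g ≡ ∑ (shuffles (suc n) s) (g ∘ (true ∷_)) + ∑ (shuffles n (suc s)) (g ∘ (false ∷_))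
∑-shuffles-suc-suc n s g = trans (∑-++ (map (true ∷_) (shuffles (suc n) s)) _ g)
  (cong₂ _+_ (∑-map (true ∷_) (shuffles (suc n) s) g) (∑-map (false ∷_) (shuffles n (suc s)) g))

∑-allMasks-δ-trues-vanishes : ∀ L s (g : List Bool → ℕ) → L < s → ∑ (allMasks L) (λ b → δ (trues b) s * g b) ≡ 0
∑-allMasks-δ-trues-vanishes zero (suc s) g _ = refl
∑-allMasks-δ-trues-vanishes (suc L) (suc s) g (s≤s L<s) = trans (∑-allMasks-suc L _)
  (cong₂ _+_ (∑-allMasks-δ-trues-vanishes L s (g ∘ (true ∷_)) L<s)
             (∑-allMasks-δ-trues-vanishes L (suc s) (g ∘ (false ∷_)) (m<n⇒m<1+n L<s)))

∑-allMasks≡∑-shuffles : ∀ n s (g : List Bool → ℕ) → ∑ (allMasks (n + s)) (λ b → δ (trues b) s * g b) ≡ ∑ (shuffles n s) g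
∑-allMasks≡∑-shuffles zero zero g = cong (_+ 0) (*-identityˡ (g []))
∑-allMasks≡∑-shuffles zero (suc s) g = begin
  ∑ (allMasks (suc s)) (λ b → δ (trues b) (suc s) * g b)
    ≡⟨ ∑-allMasks-suc s _ ⟩
  ∑ (allMasks s) (λ b → δ (trues b) s * g (true ∷ b)) + ∑ (allMasks s) (λ b → δ (trues b) (suc s) * g (false ∷ b))
    ≡⟨ cong₂ _+_ (∑-allMasks≡∑-shuffles zero s _) (∑-allMasks-δ-trues-vanishes s (suc s) _ ≤-refl) ⟩
  ∑ (shuffles zero s) (g ∘ (true ∷_)) + 0
    ≡⟨ +-identityʳ _ ⟩
  ∑ (shuffles zero s) (g ∘ (true ∷_))
    ≡⟨ sym (∑-map (true ∷_) (shuffles zero s) g) ⟩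
  ∑ (shuffles zero (suc s)) g
    ∎
∑-allMasks≡∑-shuffles (suc n) zero g = begin
  ∑ (allMasks (suc (n + 0))) (λ b → δ (trues b) 0 * g b)
    ≡⟨ ∑-allMasks-suc (n + 0) _ ⟩
  ∑ (allMasks (n + 0)) (λ b → 0) + ∑ (allMasks (n + 0)) (λ b → δ (trues b) 0 * g (false ∷ b))
    ≡⟨ cong₂ _+_ (∑-zero (allMasks (n + 0)) λ _ → refl) (∑-allMasks≡∑-shuffles n zero _) ⟩
  ∑ (shuffles n zero) (g ∘ (false ∷_))
    ≡⟨ sym (∑-map (false ∷_) (shuffles n zero) g) ⟩
  ∑ (shuffles (suc n) zero) g
    ∎
∑-allMasks≡∑-shuffles (suc n) (suc s) g = begin
  ∑ (allMasks (suc (n + suc s))) (λ b → δ (trues b) (suc s) * g b)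
    ≡⟨ ∑-allMasks-suc (n + suc s) _ ⟩
  ∑ (allMasks (n + suc s)) (λ b → δ (trues b) s * g (true ∷ b)) + ∑ (allMasks (n + suc s)) (λ b → δ (trues b) (suc s) * g (false ∷ b))
    ≡⟨ cong₂ _+_ (trans (cong (λ L → ∑ (allMasks L) (λ b → δ (trues b) s * g (true ∷ b))) (+-suc n s))
                        (∑-allMasks≡∑-shuffles (suc n) s _))
                 (∑-allMasks≡∑-shuffles n (suc s) _) ⟩
  ∑ (shuffles (suc n) s) (g ∘ (true ∷_)) + ∑ (shuffles n (suc s)) (g ∘ (false ∷_))
    ≡⟨ sym (∑-shuffles-suc-suc n s g) ⟩
  ∑ (shuffles (suc n) (suc s)) g
    ∎

-- Loops after inserting a block

module _ {m : ℕ} where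

  -- The gap after a letter is a loop gap if the next letter is equal to it and open otherwise;
  -- the gap at the end of the word is open.
  openGapsAfter : Fin m → List (Fin m) → ℕ
  openGapsAfter y [] = 1
  openGapsAfter y (z ∷ u) = 𝟙 (not (toℕ y ≡ᵇ toℕ z)) + openGapsAfter z u

  openGaps : List (Fin m) → ℕ
  openGaps [] = 0
  openGaps (y ∷ u) = openGapsAfter y u

  openGapsAfter+loops : ∀ y u → openGapsAfter y u + loops (y ∷ u) ≡ suc (length u)
  openGapsAfter+loops y [] = refl
  openGapsAfter+loops y (z ∷ u) with toℕ y ≡ᵇ toℕ z
  ... | true = trans (+-suc (openGapsAfter z u) (loops (z ∷ u))) (cong suc (openGapsAfter+loops z u))
  ... | false = cong suc (openGapsAfter+loops z u)

  openGaps+loops≡length : ∀ w → openGaps w + loops w ≡ length w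
  openGaps+loops≡length [] = refl
  openGaps+loops≡length (y ∷ u) = openGapsAfter+loops y u

private
  x+0+0+0≡x : ∀ x → x + 0 + 0 + 0 ≡ x
  x+0+0+0≡x = solve-∀
  x+1+0+0≡1+x : ∀ x → x + 1 + 0 + 0 ≡ suc x
  x+1+0+0≡1+x = solve-∀
  x+0+y≡y+x : ∀ x y → x + 0 + y ≡ y + x
  x+0+y≡y+x = solve-∀
  x+[1+y]+z+z≡1+x+y+z+z : ∀ x y z → x + suc y + z + z ≡ suc (x + y + z + z)
  x+[1+y]+z+z≡1+x+y+z+z = solve-∀
  x+y+[1+z]+[1+z]≡2+x+y+z+z : ∀ x y z → x + y + suc z + suc z ≡ suc (suc (x + y + z + z))
  x+y+[1+z]+[1+z]≡2+x+y+z+z = solve-∀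
  x+[1+y]+z≡x+y+[z+1] : ∀ x y z → x + suc y + z ≡ x + y + (z + 1)
  x+[1+y]+z≡x+y+[z+1] = solve-∀
  [1+x]+[1+y]+z≡2+x+y+z : ∀ x y z → suc x + suc y + z ≡ suc (suc (x + y + z))
  [1+x]+[1+y]+z≡2+x+y+z = solve-∀

-- frontForm P L s o k counts the ways to place s new points in the P open and L loop gaps of
-- an old word preceded by one new point so that, with o loops already present, there are k
-- loops. Filling a chosen open and b chosen loop gaps (the remaining new points follow the
-- first one) can be done in s C (a + b) ways and leaves o + (L − b) + (s − a − b) loops.
-- afterForm is the same count for an old word preceded by an old letter, where no new point
-- can go to the front: compositions s (a + b) ways.
frontForm afterForm : ℕ → ℕ → ℕ → ℕ → ℕ → ℕ
frontForm P L s o k = ∑⊆² P L λ a b → (s C (a + b)) * δ (k + a + b + b) (s + L + o)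
afterForm P L s o k = ∑⊆² P L λ a b → compositions s (a + b) * δ (k + a + b + b) (s + L + o)

frontForm-empty : ∀ s o k → frontForm 0 0 s o k ≡ δ (o + s) k
frontForm-empty s o k = begin
  δ (k + 0 + 0 + 0) (s + 0 + o) + 0 + 0 + 0 ≡⟨ trans (+-identityʳ _) (trans (+-identityʳ _) (+-identityʳ _)) ⟩
  δ (k + 0 + 0 + 0) (s + 0 + o)             ≡⟨ cong₂ δ (x+0+0+0≡x k) (x+0+y≡y+x s o) ⟩
  δ k (o + s)                               ≡⟨ δ-sym k (o + s) ⟩
  δ (o + s) k                               ∎

afterForm-empty : ∀ s o k → afterForm 1 0 s o k ≡ δ (o + pred s) k
afterForm-empty zero o k = begin
  δ (k + 0 + 0 + 0) o + 0 + 0 + 0 ≡⟨ trans (+-identityʳ _) (trans (+-identityʳ _) (+-identityʳ _)) ⟩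
  δ (k + 0 + 0 + 0) o             ≡⟨ trans (δ-congˡ o (x+0+0+0≡x k)) (δ-sym k o) ⟩
  δ o k                           ≡⟨ δ-congˡ k (sym (+-identityʳ o)) ⟩
  δ (o + 0) k                     ∎
afterForm-empty (suc s) o k = begin
  δ (k + 1 + 0 + 0) (suc (s + 0 + o)) + 0 + 0 + 0 ≡⟨ trans (+-identityʳ _) (trans (+-identityʳ _) (+-identityʳ _)) ⟩
  δ (k + 1 + 0 + 0) (suc (s + 0 + o))         ≡⟨ cong₂ δ (x+1+0+0≡1+x k) (cong suc (x+0+y≡y+x s o)) ⟩
  δ k (o + s)                                 ≡⟨ δ-sym k (o + s) ⟩
  δ (o + s) k                                 ∎

afterForm-zero≡frontForm : ∀ P L o k → afterForm P L 0 o k ≡ frontForm P L 0 o k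
afterForm-zero≡frontForm P L o k =
  ∑⊆²-cong P L λ a b → cong (_* δ (k + a + b + b) (L + o)) (compositions-zero (a + b))

frontForm-suc : ∀ P L s o k → frontForm P L (suc s) o k ≡ frontForm P L s (suc o) k + afterForm P L (suc s) o k
frontForm-suc P L s o k = trans (∑⊆²-cong P L split) (∑⊆²-+ P L _ _)
  where
  split : ∀ a b → (suc s C (a + b)) * δ (k + a + b + b) (suc s + L + o)
                ≡ (s C (a + b)) * δ (k + a + b + b) (s + L + suc o) + compositions (suc s) (a + b) * δ (k + a + b + b) (suc s + L + o)
  split a b = begin
    (suc s C (a + b)) * D
      ≡⟨ cong (_* D) (suc-C≡C+compositions s (a + b)) ⟩
    ((s C (a + b)) + compositions (suc s) (a + b)) * D
      ≡⟨ *-distribʳ-+ D (s C (a + b)) _ ⟩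
    (s C (a + b)) * D + compositions (suc s) (a + b) * D
      ≡⟨ cong (λ x → (s C (a + b)) * x + compositions (suc s) (a + b) * D) (δ-congʳ (k + a + b + b) (sym (+-suc (s + L) o))) ⟩
    (s C (a + b)) * δ (k + a + b + b) (s + L + suc o) + compositions (suc s) (a + b) * D
      ∎
    where
    D : ℕ
    D = δ (k + a + b + b) (suc s + L + o)

afterForm-step : ∀ e P L s o k →
  afterForm (𝟙 (not e) + P) (𝟙 e + L) (suc s) o k ≡ frontForm P L s o k + afterForm P L (suc s) (o + 𝟙 e) k
afterForm-step false P L s o k = begin
  afterForm (suc P) L (suc s) o k
    ≡⟨ ∑⊆²-sucˡ P L _ ⟩
  afterForm P L (suc s) o k + ∑⊆² P L (λ a b → (s C (a + b)) * δ (k + suc a + b + b) (suc s + L + o))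
    ≡⟨ cong₂ _+_ (cong (λ o → afterForm P L (suc s) o k) (sym (+-identityʳ o)))
                 (∑⊆²-cong P L λ a b → cong ((s C (a + b)) *_) (δ-congˡ _ (x+[1+y]+z+z≡1+x+y+z+z k a b))) ⟩
  afterForm P L (suc s) (o + 0) k + frontForm P L s o k
    ≡⟨ +-comm (afterForm P L (suc s) (o + 0) k) _ ⟩
  frontForm P L s o k + afterForm P L (suc s) (o + 0) k
    ∎
afterForm-step true P L s o k = begin
  afterForm P (suc L) (suc s) o k
    ≡⟨ ∑⊆²-sucʳ P L _ ⟩
  ∑⊆² P L (λ a b → compositions (suc s) (a + b) * δ (k + a + b + b) (suc s + suc L + o))
    + ∑⊆² P L (λ a b → compositions (suc s) (a + suc b) * δ (k + a + suc b + suc b) (suc s + suc L + o))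
    ≡⟨ cong₂ _+_ (∑⊆²-cong P L λ a b →
                   cong (compositions (suc s) (a + b) *_) (δ-congʳ (k + a + b + b) (x+[1+y]+z≡x+y+[z+1] (suc s) L o)))
                 (∑⊆²-cong P L λ a b →
                   cong₂ _*_ (cong (compositions (suc s)) (+-suc a b))
                             (cong₂ δ (x+y+[1+z]+[1+z]≡2+x+y+z+z k a b) ([1+x]+[1+y]+z≡2+x+y+z s L o))) ⟩
  afterForm P L (suc s) (o + 1) k + frontForm P L s o k
    ≡⟨ +-comm (afterForm P L (suc s) (o + 1) k) _ ⟩
  frontForm P L s o k + afterForm P L (suc s) (o + 1) k
    ∎

afterForm-step₀ : ∀ e P L o k → afterForm (𝟙 (not e) + P) (𝟙 e + L) 0 o k ≡ afterForm P L 0 (o + 𝟙 e) k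
afterForm-step₀ false P L o k = begin
  afterForm (suc P) L 0 o k
    ≡⟨ ∑⊆²-sucˡ P L _ ⟩
  afterForm P L 0 o k + ∑⊆² P L (λ a b → 0)
    ≡⟨ cong₂ _+_ (cong (λ o → afterForm P L 0 o k) (sym (+-identityʳ o))) (∑⊆²-zero P L λ _ _ → refl) ⟩
  afterForm P L 0 (o + 0) k + 0
    ≡⟨ +-identityʳ _ ⟩
  afterForm P L 0 (o + 0) k
    ∎
afterForm-step₀ true P L o k = begin
  afterForm P (suc L) 0 o k
    ≡⟨ ∑⊆²-sucʳ P L _ ⟩
  ∑⊆² P L (λ a b → compositions 0 (a + b) * δ (k + a + b + b) (suc L + o))
    + ∑⊆² P L (λ a b → compositions 0 (a + suc b) * δ (k + a + suc b + suc b) (suc L + o))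
    ≡⟨ cong₂ _+_ (∑⊆²-cong P L λ a b → cong (compositions 0 (a + b) *_) (δ-congʳ (k + a + b + b) (x+[1+y]+z≡x+y+[z+1] 0 L o)))
                 (∑⊆²-zero P L λ a b → cong (λ j → compositions 0 j * δ (k + a + suc b + suc b) (suc L + o)) (+-suc a b)) ⟩
  afterForm P L 0 (o + 1) k + 0
    ≡⟨ +-identityʳ _ ⟩
  afterForm P L 0 (o + 1) k
    ∎

module _ {m : ℕ} where

  frontCount : List (Fin m) → ℕ → ℕ → ℕ → ℕ
  frontCount u s o k = ∑ (shuffles (length u) s) λ b → δ (o + loops (fzero ∷ insertBlock b u)) k

  afterCount : Fin m → List (Fin m) → ℕ → ℕ → ℕ → ℕ
  afterCount y u s o k = ∑ (shuffles (length u) s) λ b → δ (o + loops (fsuc y ∷ insertBlock b u)) k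

  frontCount-empty : ∀ s o k → frontCount [] s o k ≡ δ (o + s) k
  frontCount-empty zero o k = +-identityʳ _
  frontCount-empty (suc s) o k = begin
    frontCount [] (suc s) o k
      ≡⟨ ∑-map (true ∷_) (shuffles 0 s) _ ⟩
    ∑ (shuffles 0 s) (λ b → δ (o + suc (loops (fzero ∷ insertBlock b []))) k)
      ≡⟨ ∑-cong (shuffles 0 s) (λ b → δ-congˡ k (+-suc o _)) ⟩
    frontCount [] s (suc o) k
      ≡⟨ frontCount-empty s (suc o) k ⟩
    δ (suc o + s) k
      ≡⟨ δ-congˡ k (sym (+-suc o s)) ⟩
    δ (o + suc s) k
      ∎

  -- Reading the mask from the left, the counts obey the recurrences frontForm-suc,
  -- afterForm-step and afterForm-step₀ of the closed forms.
  mutual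
    frontCount≡frontForm : ∀ u s o k → frontCount u s o k ≡ frontForm (openGaps u) (loops u) s o k
    frontCount≡frontForm [] s o k = trans (frontCount-empty s o k) (sym (frontForm-empty s o k))
    frontCount≡frontForm (y ∷ u) zero o k = begin
      frontCount (y ∷ u) 0 o k
        ≡⟨ ∑-map (false ∷_) (shuffles (length u) 0) _ ⟩
      afterCount y u 0 o k
        ≡⟨ afterCount≡afterForm y u 0 o k ⟩
      afterForm (openGapsAfter y u) (loops (y ∷ u)) 0 o k
        ≡⟨ afterForm-zero≡frontForm (openGapsAfter y u) (loops (y ∷ u)) o k ⟩
      frontForm (openGapsAfter y u) (loops (y ∷ u)) 0 o k
        ∎
    frontCount≡frontForm (y ∷ u) (suc s) o k = begin
      frontCount (y ∷ u) (suc s) o k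
        ≡⟨ ∑-shuffles-suc-suc (length u) s _ ⟩
      ∑ (shuffles (suc (length u)) s) (λ b → δ (o + suc (loops (fzero ∷ insertBlock b (y ∷ u)))) k) + afterCount y u (suc s) o k
        ≡⟨ cong (_+ afterCount y u (suc s) o k) (∑-cong (shuffles (suc (length u)) s) (λ b → δ-congˡ k (+-suc o _))) ⟩
      frontCount (y ∷ u) s (suc o) k + afterCount y u (suc s) o k
        ≡⟨ cong₂ _+_ (frontCount≡frontForm (y ∷ u) s (suc o) k) (afterCount≡afterForm y u (suc s) o k) ⟩
      frontForm P L s (suc o) k + afterForm P L (suc s) o k
        ≡⟨ sym (frontForm-suc P L s o k) ⟩
      frontForm P L (suc s) o k
        ∎
      where
      P L : ℕ
      P = openGapsAfter y u
      L = loops (y ∷ u)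

    afterCount≡afterForm : ∀ y u s o k → afterCount y u s o k ≡ afterForm (openGapsAfter y u) (loops (y ∷ u)) s o k
    afterCount≡afterForm y [] zero o k = trans (+-identityʳ _) (sym (afterForm-empty 0 o k))
    afterCount≡afterForm y [] (suc s) o k =
      trans (∑-map (true ∷_) (shuffles 0 s) _) (trans (frontCount-empty s o k) (sym (afterForm-empty (suc s) o k)))
    afterCount≡afterForm y (z ∷ u) zero o k = begin
      afterCount y (z ∷ u) 0 o k
        ≡⟨ ∑-map (false ∷_) (shuffles (length u) 0) _ ⟩
      ∑ (shuffles (length u) 0) (λ b → δ (o + (𝟙 e + loops (fsuc z ∷ insertBlock b u))) k)
        ≡⟨ ∑-cong (shuffles (length u) 0) (λ b → δ-congˡ k (sym (+-assoc o (𝟙 e) _))) ⟩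
      afterCount z u 0 (o + 𝟙 e) k
        ≡⟨ afterCount≡afterForm z u 0 (o + 𝟙 e) k ⟩
      afterForm (openGapsAfter z u) (loops (z ∷ u)) 0 (o + 𝟙 e) k
        ≡⟨ sym (afterForm-step₀ e (openGapsAfter z u) (loops (z ∷ u)) o k) ⟩
      afterForm (openGapsAfter y (z ∷ u)) (loops (y ∷ z ∷ u)) 0 o k
        ∎
      where
      e : Bool
      e = toℕ y ≡ᵇ toℕ z
    afterCount≡afterForm y (z ∷ u) (suc s) o k = begin
      afterCount y (z ∷ u) (suc s) o k
        ≡⟨ ∑-shuffles-suc-suc (length u) s _ ⟩
      frontCount (z ∷ u) s o k + ∑ (shuffles (length u) (suc s)) (λ b → δ (o + (𝟙 e + loops (fsuc z ∷ insertBlock b u))) k)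
        ≡⟨ cong (frontCount (z ∷ u) s o k +_) (∑-cong (shuffles (length u) (suc s)) (λ b → δ-congˡ k (sym (+-assoc o (𝟙 e) _)))) ⟩
      frontCount (z ∷ u) s o k + afterCount z u (suc s) (o + 𝟙 e) k
        ≡⟨ cong₂ _+_ (frontCount≡frontForm (z ∷ u) s o k) (afterCount≡afterForm z u (suc s) (o + 𝟙 e) k) ⟩
      frontForm (openGapsAfter z u) (loops (z ∷ u)) s o k + afterForm (openGapsAfter z u) (loops (z ∷ u)) (suc s) (o + 𝟙 e) k
        ≡⟨ sym (afterForm-step e (openGapsAfter z u) (loops (z ∷ u)) s o k) ⟩
      afterForm (openGapsAfter y (z ∷ u)) (loops (y ∷ z ∷ u)) (suc s) o k
        ∎
      where
      e : Bool
      e = toℕ y ≡ᵇ toℕ z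

-- The triple binomial sum

_C[_∸_] : ℕ → ℕ → ℕ → ℕ
a C[ b ∸ c ] with c ≤? b
... | yes _ = a C (b ∸ c)
... | no _ = 0

C[∸]-≰ : ∀ a b c → ¬ c ≤ b → a C[ b ∸ c ] ≡ 0
C[∸]-≰ a b c c≰b with c ≤? b
... | yes c≤b = ⊥-elim (c≰b c≤b)
... | no _ = refl

tripleSum : ℕ → ℕ → ℕ → ℕ → ℕ
tripleSum s P L k = Σ< (suc s) λ i → (s C i) * (L C[ L + i ∸ k ] * P C[ s + k ∸ (i + i + L) ])

solve-loopSystem : ∀ s L k i a b → a + b + i ≡ s → k + a + b + b ≡ s + L + 0 →
  k + b ≡ L + i × a + (i + i + L) ≡ s + k
solve-loopSystem s L k i a b e₁ e₂ = k+b≡L+i , a-eq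
  where
  k+b≡L+i : k + b ≡ L + i
  k+b≡L+i = +-cancelˡ-≡ (a + b) _ _ (begin
    a + b + (k + b)   ≡⟨ solve (a ∷ b ∷ k ∷ []) ⟩
    k + a + b + b     ≡⟨ e₂ ⟩
    s + L + 0         ≡⟨ cong (λ x → x + L + 0) (sym e₁) ⟩
    a + b + i + L + 0 ≡⟨ solve (a ∷ b ∷ i ∷ L ∷ []) ⟩
    a + b + (L + i)   ∎)
  a-eq : a + (i + i + L) ≡ s + k
  a-eq = begin
    a + (i + i + L) ≡⟨ solve (a ∷ i ∷ L ∷ []) ⟩
    a + i + (L + i) ≡⟨ cong (a + i +_) (sym k+b≡L+i) ⟩
    a + i + (k + b) ≡⟨ solve (a ∷ i ∷ k ∷ b ∷ []) ⟩
    a + b + i + k   ≡⟨ cong (_+ k) e₁ ⟩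
    s + k           ∎

loopSystem-solution : ∀ s L k i a b → k + b ≡ L + i → a + (i + i + L) ≡ s + k →
  a + b + i ≡ s × k + a + b + b ≡ s + L + 0
loopSystem-solution s L k i a b kb≡ ae≡ = e₁ , e₂
  where
  e₁ : a + b + i ≡ s
  e₁ = +-cancelˡ-≡ k _ _ (begin
    k + (a + b + i)   ≡⟨ solve (k ∷ a ∷ b ∷ i ∷ []) ⟩
    a + (k + b) + i   ≡⟨ cong (λ x → a + x + i) kb≡ ⟩
    a + (L + i) + i   ≡⟨ solve (a ∷ L ∷ i ∷ []) ⟩
    a + (i + i + L)   ≡⟨ ae≡ ⟩
    s + k             ≡⟨ +-comm s k ⟩
    k + s             ∎)
  e₂ : k + a + b + b ≡ s + L + 0
  e₂ = begin
    k + a + b + b     ≡⟨ solve (k ∷ a ∷ b ∷ []) ⟩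
    a + b + (k + b)   ≡⟨ cong (a + b +_) kb≡ ⟩
    a + b + (L + i)   ≡⟨ solve (a ∷ b ∷ L ∷ i ∷ []) ⟩
    a + b + i + L + 0 ≡⟨ cong (λ x → x + L + 0) e₁ ⟩
    s + L + 0         ∎

∑⊆²-loopSystem : ∀ s P L k i →
  ∑⊆² P L (λ a b → δ (a + b + i) s * δ (k + a + b + b) (s + L + 0)) ≡ L C[ L + i ∸ k ] * P C[ s + k ∸ (i + i + L) ]
∑⊆²-loopSystem s P L k i with k ≤? L + i | i + i + L ≤? s + k
... | yes k≤L+i | yes 2i+L≤s+k = begin
  ∑⊆² P L (λ a b → δ (a + b + i) s * δ (k + a + b + b) (s + L + 0)) ≡⟨ ∑⊆²-cong P L (λ a b → δ*δ-cong (⇒ a b) (⇐ a b)) ⟩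
  ∑⊆² P L (λ a b → δ a a₀ * δ b b₀)                                     ≡⟨ ∑⊆²-δδ P L a₀ b₀ ⟩
  (P C a₀) * (L C b₀)                                                   ≡⟨ *-comm (P C a₀) (L C b₀) ⟩
  (L C b₀) * (P C a₀)                                                   ∎
  where
  a₀ b₀ : ℕ
  a₀ = s + k ∸ (i + i + L)
  b₀ = L + i ∸ k
  k+b₀≡L+i : k + b₀ ≡ L + i
  k+b₀≡L+i = m+[n∸m]≡n k≤L+i
  a₀+2i+L≡s+k : a₀ + (i + i + L) ≡ s + k
  a₀+2i+L≡s+k = m∸n+n≡m 2i+L≤s+k
  ⇒ : ∀ a b → a + b + i ≡ s → k + a + b + b ≡ s + L + 0 → a ≡ a₀ × b ≡ b₀
  ⇒ a b e₁ e₂ with solve-loopSystem s L k i a b e₁ e₂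
  ... | k+b≡L+i , a+2i+L≡s+k = m+n≡o⇒m≡o∸n (i + i + L) a+2i+L≡s+k , m+n≡o⇒n≡o∸m k k+b≡L+i
  ⇐ : ∀ a b → a ≡ a₀ → b ≡ b₀ → a + b + i ≡ s × k + a + b + b ≡ s + L + 0
  ⇐ a b refl refl = loopSystem-solution s L k i a₀ b₀ k+b₀≡L+i a₀+2i+L≡s+k
... | yes _ | no 2i+L≰s+k = trans (∑⊆²-zero P L λ a b → δ*δ-≢ λ (e₁ , e₂) →
        2i+L≰s+k (subst (i + i + L ≤_) (proj₂ (solve-loopSystem s L k i a b e₁ e₂)) (m≤n+m _ a)))
      (sym (*-zeroʳ (L C (L + i ∸ k))))
... | no k≰L+i | _ = ∑⊆²-zero P L λ a b → δ*δ-≢ λ (e₁ , e₂) →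
        k≰L+i (subst (k ≤_) (proj₁ (solve-loopSystem s L k i a b e₁ e₂)) (m≤m+n k b))

frontForm≡tripleSum : ∀ s P L k → frontForm P L s 0 k ≡ tripleSum s P L k
frontForm≡tripleSum s P L k = begin
  ∑⊆² P L (λ a b → (s C (a + b)) * E a b)
    ≡⟨ ∑⊆²-cong P L (λ a b → cong (_* E a b) (C-as-Σ<-complement s (a + b))) ⟩
  ∑⊆² P L (λ a b → Σ< (suc s) (λ i → (s C i) * δ (a + b + i) s) * E a b)
    ≡⟨ ∑⊆²-cong P L (λ a b → distribute a b) ⟩
  ∑⊆² P L (λ a b → Σ< (suc s) (λ i → (s C i) * (δ (a + b + i) s * E a b)))
    ≡⟨ ∑⊆²-∑ P L (upTo (suc s)) _ ⟩
  Σ< (suc s) (λ i → ∑⊆² P L (λ a b → (s C i) * (δ (a + b + i) s * E a b)))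
    ≡⟨ ∑-cong (upTo (suc s)) (λ i → trans (∑⊆²-*ˡ P L (s C i) _) (cong ((s C i) *_) (∑⊆²-loopSystem s P L k i))) ⟩
  tripleSum s P L k
    ∎
  where
  E : ℕ → ℕ → ℕ
  E a b = δ (k + a + b + b) (s + L + 0)
  distribute : ∀ a b → Σ< (suc s) (λ i → (s C i) * δ (a + b + i) s) * E a b ≡ Σ< (suc s) (λ i → (s C i) * (δ (a + b + i) s * E a b))
  distribute a b = begin
    Σ< (suc s) (λ i → (s C i) * δ (a + b + i) s) * E a b
      ≡⟨ *-comm _ (E a b) ⟩
    E a b * Σ< (suc s) (λ i → (s C i) * δ (a + b + i) s)
      ≡⟨ sym (∑-*ˡ (upTo (suc s)) (E a b) _) ⟩
    Σ< (suc s) (λ i → E a b * ((s C i) * δ (a + b + i) s))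
      ≡⟨ ∑-cong (upTo (suc s)) (λ i → trans (*-left-comm (E a b) (s C i) _) (cong ((s C i) *_) (*-comm (E a b) _))) ⟩
    Σ< (suc s) (λ i → (s C i) * (δ (a + b + i) s * E a b))
      ∎

-- Both sides as sums over diagrams with one block fewer

∑-allMasks-insertions : ∀ {m} s (w : List (Fin m)) k →
  ∑ (allMasks (s + length w)) (λ b → δ (trues b) s * δ (loops (fzero ∷ insertBlock b w)) k) ≡ tripleSum s (openGaps w) (loops w) k
∑-allMasks-insertions s w k = begin
  ∑ (allMasks (s + length w)) (λ b → δ (trues b) s * δ (loops (fzero ∷ insertBlock b w)) k)
    ≡⟨ cong (λ L → ∑ (allMasks L) (λ b → δ (trues b) s * δ (loops (fzero ∷ insertBlock b w)) k)) (+-comm s (length w)) ⟩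
  ∑ (allMasks (length w + s)) (λ b → δ (trues b) s * δ (loops (fzero ∷ insertBlock b w)) k)
    ≡⟨ ∑-allMasks≡∑-shuffles (length w) s _ ⟩
  frontCount w s 0 k
    ≡⟨ frontCount≡frontForm w s 0 k ⟩
  frontForm (openGaps w) (loops w) s 0 k
    ≡⟨ frontForm≡tripleSum s (openGaps w) (loops w) k ⟩
  tripleSum s (openGaps w) (loops w) k
    ∎

module _ (s m k : ℕ) where

  private
    d n : ℕ
    d = suc s
    n = m * d

    isDiagramWithLoops : List (Fin (suc m)) → Bool
    isDiagramWithLoops v = isDiagram (suc m) d v ∧ (loops v ≡ᵇ k)

    weight : List Bool → List (Fin m) → ℕ
    weight b w = 𝟙 (isDiagram m d w) * δ (loops (fzero ∷ insertBlock b w)) k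

  𝟙-isDiagramWithLoops-insertBlock : ∀ b w → length w ≡ falses b →
    𝟙 (isDiagramWithLoops (fzero ∷ insertBlock b w)) ≡ δ (trues b) s * weight b w
  𝟙-isDiagramWithLoops-insertBlock b w lw = begin
    𝟙 (isDiagram (suc m) d (fzero ∷ insertBlock b w) ∧ ℓ≡k)
      ≡⟨ cong (λ x → 𝟙 (x ∧ ℓ≡k)) (isDiagram-insertBlock m d b w lw) ⟩
    𝟙 (((suc (trues b) ≡ᵇ d) ∧ isDiagram m d w) ∧ ℓ≡k)
      ≡⟨ cong 𝟙 (∧-assoc (suc (trues b) ≡ᵇ d) (isDiagram m d w) ℓ≡k) ⟩
    𝟙 ((suc (trues b) ≡ᵇ d) ∧ (isDiagram m d w ∧ ℓ≡k))
      ≡⟨ trans (𝟙-∧ (suc (trues b) ≡ᵇ d) _) (cong (δ (trues b) s *_) (𝟙-∧ (isDiagram m d w) ℓ≡k)) ⟩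
    δ (trues b) s * weight b w
      ∎
    where
    ℓ≡k : Bool
    ℓ≡k = loops (fzero ∷ insertBlock b w) ≡ᵇ k

  no-diagram-starts-with-old-block : ∀ b → ∑ (allWords m (suc (falses b))) (𝟙 ∘ isDiagramWithLoops ∘ insertBlock (false ∷ b)) ≡ 0
  no-diagram-starts-with-old-block b =
    trans (∑-allWords-suc m (falses b) _) (∑-zero (allFin m) λ y → ∑-zero (allWords m (falses b)) λ w → refl)

  ∑-allWords-insertBlock : ∀ b → length b ≡ s + n →
    ∑ (allWords m (falses b)) (λ w → 𝟙 (isDiagramWithLoops (fzero ∷ insertBlock b w)))
      ≡ ∑ (allWords m n) (λ w → δ (trues b) s * weight b w)
  ∑-allWords-insertBlock b lb with trues b ≟ s
  ... | yes trues≡s = trans (∑-cong-All (allWords-length m (falses b)) (𝟙-isDiagramWithLoops-insertBlock b))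
                            (cong (λ L → ∑ (allWords m L) (λ w → δ (trues b) s * weight b w)) falses≡n)
    where
    falses≡n : falses b ≡ n
    falses≡n = +-cancelˡ-≡ s _ _ (trans (cong (_+ falses b) (sym trues≡s)) (trans (trues+falses≡length b) lb))
  ... | no trues≢s = trans (∑-zero-All (allWords-length m (falses b)) λ w lw →
                             trans (𝟙-isDiagramWithLoops-insertBlock b w lw) (cong (_* weight b w) (δ-≢ trues≢s)))
                           (sym (∑-zero (allWords m n) λ w → cong (_* weight b w) (δ-≢ trues≢s)))

  ∑-allMasks-weight : ∀ w → length w ≡ n →
    ∑ (allMasks (s + n)) (λ b → δ (trues b) s * weight b w) ≡ 𝟙 (isDiagram m d w) * tripleSum s (openGaps w) (loops w) k
  ∑-allMasks-weight w lw = begin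
    ∑ (allMasks (s + n)) (λ b → δ (trues b) s * (𝟙 (isDiagram m d w) * δ (loops (fzero ∷ insertBlock b w)) k))
      ≡⟨ ∑-cong (allMasks (s + n)) (λ b → *-left-comm (δ (trues b) s) (𝟙 (isDiagram m d w)) _) ⟩
    ∑ (allMasks (s + n)) (λ b → 𝟙 (isDiagram m d w) * insertions b)
      ≡⟨ ∑-*ˡ (allMasks (s + n)) (𝟙 (isDiagram m d w)) insertions ⟩
    𝟙 (isDiagram m d w) * ∑ (allMasks (s + n)) insertions
      ≡⟨ cong (λ L → 𝟙 (isDiagram m d w) * ∑ (allMasks (s + L)) insertions) (sym lw) ⟩
    𝟙 (isDiagram m d w) * ∑ (allMasks (s + length w)) insertions
      ≡⟨ cong (𝟙 (isDiagram m d w) *_) (∑-allMasks-insertions s w k) ⟩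
    𝟙 (isDiagram m d w) * tripleSum s (openGaps w) (loops w) k
      ∎
    where
    insertions : List Bool → ℕ
    insertions b = δ (trues b) s * δ (loops (fzero ∷ insertBlock b w)) k

  aN-by-first-block :
    aN (suc s) (suc m) k ≡ ∑ (allWords m (m * suc s)) (λ w → 𝟙 (isDiagram m (suc s) w) * tripleSum s (openGaps w) (loops w) k)
  aN-by-first-block = begin
    aN d (suc m) k
      ≡⟨ length-filterᵇ isDiagramWithLoops (allWords (suc m) (suc (s + n))) ⟩
    ∑ (allWords (suc m) (suc (s + n))) (𝟙 ∘ isDiagramWithLoops)
      ≡⟨ ∑-allWords-by-block₀ m (suc (s + n)) (𝟙 ∘ isDiagramWithLoops) ⟩
    ∑ (allMasks (suc (s + n))) (λ b → ∑ (allWords m (falses b)) (𝟙 ∘ isDiagramWithLoops ∘ insertBlock b))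
      ≡⟨ ∑-allMasks-suc (s + n) _ ⟩
    ∑ (allMasks (s + n)) (λ b → ∑ (allWords m (falses b)) (λ w → 𝟙 (isDiagramWithLoops (fzero ∷ insertBlock b w))))
      + ∑ (allMasks (s + n)) (λ b → ∑ (allWords m (suc (falses b))) (𝟙 ∘ isDiagramWithLoops ∘ insertBlock (false ∷ b)))
      ≡⟨ cong₂ _+_ (∑-cong-All (allMasks-length (s + n)) λ b → ∑-allWords-insertBlock b)
                   (∑-zero (allMasks (s + n)) no-diagram-starts-with-old-block) ⟩
    ∑ (allMasks (s + n)) (λ b → ∑ (allWords m n) (λ w → δ (trues b) s * weight b w)) + 0
      ≡⟨ +-identityʳ _ ⟩
    ∑ (allMasks (s + n)) (λ b → ∑ (allWords m n) (λ w → δ (trues b) s * weight b w))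
      ≡⟨ ∑-comm (allMasks (s + n)) (allWords m n) _ ⟩
    ∑ (allWords m n) (λ w → ∑ (allMasks (s + n)) (λ b → δ (trues b) s * weight b w))
      ≡⟨ ∑-cong-All (allWords-length m n) ∑-allMasks-weight ⟩
    ∑ (allWords m n) (λ w → 𝟙 (isDiagram m d w) * tripleSum s (openGaps w) (loops w) k)
      ∎

Σ<-window : ∀ s k ℓ → k ≤ ℓ + s → ℓ ≤ k + s → Σ< (suc (s + s)) (λ j → δ (k + j) (ℓ + s)) ≡ 1
Σ<-window s k ℓ k≤ℓ+s ℓ≤k+s =
  trans (Σ<-single (suc (s + s)) _ (s≤s j₀≤s+s) (λ j j≢j₀ → δ-≢ λ k+j≡ℓ+s → j≢j₀ (m+n≡o⇒n≡o∸m k k+j≡ℓ+s)))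
        (δ-≡ (m+[n∸m]≡n k≤ℓ+s))
  where
  j₀ : ℕ
  j₀ = ℓ + s ∸ k
  j₀≤s+s : j₀ ≤ s + s
  j₀≤s+s = subst (j₀ ≤_) (trans (cong (_∸ k) (+-assoc k s s)) (m+n∸m≡n k (s + s))) (∸-monoˡ-≤ k (+-monoˡ-≤ s ℓ≤k+s))

tripleSum-≰ˡ : ∀ s P ℓ k → ¬ k ≤ ℓ + s → tripleSum s P ℓ k ≡ 0
tripleSum-≰ˡ s P ℓ k k≰ℓ+s = Σ<-zero (suc s) λ i i<1+s →
  trans (cong (λ x → (s C i) * (x * P C[ s + k ∸ (i + i + ℓ) ])) (C[∸]-≰ ℓ (ℓ + i) k λ k≤ℓ+i →
          k≰ℓ+s (≤-trans k≤ℓ+i (+-monoʳ-≤ ℓ (≤-pred i<1+s)))))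
        (*-zeroʳ (s C i))

tripleSum-≰ʳ : ∀ s P ℓ k → ¬ ℓ ≤ k + s → tripleSum s P ℓ k ≡ 0
tripleSum-≰ʳ s P ℓ k ℓ≰k+s = Σ<-zero (suc s) λ i _ →
  trans (cong (λ x → (s C i) * (ℓ C[ ℓ + i ∸ k ] * x)) (C[∸]-≰ P (s + k) (i + i + ℓ) λ 2i+ℓ≤s+k →
          ℓ≰k+s (≤-trans (m≤n+m ℓ (i + i)) (subst (i + i + ℓ ≤_) (+-comm s k) 2i+ℓ≤s+k))))
        (trans (cong ((s C i) *_) (*-zeroʳ (ℓ C[ ℓ + i ∸ k ]))) (*-zeroʳ (s C i)))

tripleSum-window : ∀ s P ℓ k → tripleSum s P ℓ k * Σ< (suc (s + s)) (λ j → δ (k + j) (ℓ + s)) ≡ tripleSum s P ℓ k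
tripleSum-window s P ℓ k = collapse (k ≤? ℓ + s) (ℓ ≤? k + s)
  where
  window : ℕ
  window = Σ< (suc (s + s)) (λ j → δ (k + j) (ℓ + s))
  vanish : tripleSum s P ℓ k ≡ 0 → tripleSum s P ℓ k * window ≡ tripleSum s P ℓ k
  vanish T≡0 = trans (cong (_* window) T≡0) (sym T≡0)
  collapse : Dec (k ≤ ℓ + s) → Dec (ℓ ≤ k + s) → tripleSum s P ℓ k * window ≡ tripleSum s P ℓ k
  collapse (yes k≤ℓ+s) (yes ℓ≤k+s) = trans (cong (tripleSum s P ℓ k *_) (Σ<-window s k ℓ k≤ℓ+s ℓ≤k+s)) (*-identityʳ _)
  collapse (yes _) (no ℓ≰k+s) = vanish (tripleSum-≰ʳ s P ℓ k ℓ≰k+s)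
  collapse (no k≰ℓ+s) _ = vanish (tripleSum-≰ˡ s P ℓ k k≰ℓ+s)

-- ℤ's prefix +_ is opened only here, since it makes sections such as (x +_) on ℕ ambiguous.
module _ where

  open Int using (+_; _-_)

  ⊖-≰⇒negative : ∀ {b c} → ¬ c ≤ b → ∃ λ n → b ⊖ c ≡ -[1+ n ]
  ⊖-≰⇒negative {b} {c} c≰b rewrite ⊖-≰ c≰b with c ∸ b | m>n⇒m∸n≢0 (≰⇒> c≰b)
  ... | zero | c∸b≢0 = ⊥-elim (c∸b≢0 refl)
  ... | suc n | _ = n , refl

  binomZ-⊖ : ∀ a b c → binomZ (+ a) (b ⊖ c) ≡ a C[ b ∸ c ]
  binomZ-⊖ a b c with c ≤? b
  ... | yes c≤b rewrite ⊖-≥ c≤b = refl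
  ... | no c≰b with ⊖-≰⇒negative c≰b
  ...   | n , b⊖c≡-[1+n] rewrite b⊖c≡-[1+n] = refl

  coef≡tripleSum : ∀ s m P L k → P + L ≡ suc s * m → coef (suc s) (suc m) k (+ L) ≡ tripleSum s P L k
  coef≡tripleSum s m P L k P+L≡ = ∑-cong (upTo (suc s)) λ i → begin
    (s C i) * binomZ (+ L) ((+ L Int.+ + i) - + k) * binomZ (+ (suc s * m) - + L) ((((+ suc s - + (2 * i)) - + L) Int.+ + k) - + 1)
      ≡⟨ *-assoc (s C i) _ _ ⟩
    (s C i) * (binomZ (+ L) ((+ L Int.+ + i) - + k) * binomZ (+ (suc s * m) - + L) ((((+ suc s - + (2 * i)) - + L) Int.+ + k) - + 1))
      ≡⟨ cong ((s C i) *_) (cong₂ _*_ (cong (binomZ (+ L)) ([+m]-[+n]≡m⊖n (L + i) k))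
                                       (cong₂ binomZ upper (lower i))) ⟩
    (s C i) * (binomZ (+ L) ((L + i) ⊖ k) * binomZ (+ P) ((s + k) ⊖ (i + i + L)))
      ≡⟨ cong ((s C i) *_) (cong₂ _*_ (binomZ-⊖ L (L + i) k) (binomZ-⊖ P (s + k) (i + i + L))) ⟩
    (s C i) * (L C[ L + i ∸ k ] * P C[ s + k ∸ (i + i + L) ])
      ∎
    where
    upper : + (suc s * m) - + L ≡ + P
    upper = begin
      + (suc s * m) - + L   ≡⟨ cong (λ x → + x - + L) (sym P+L≡) ⟩
      + P Int.+ + L - + L   ≡⟨ x+y-y≡x (+ P) (+ L) ⟩
      + P                   ∎
      where
      x+y-y≡x : ∀ x y → x Int.+ y - y ≡ x
      x+y-y≡x = ZR.solve-∀
    lower : ∀ i → (((+ suc s - + (2 * i)) - + L) Int.+ + k) - + 1 ≡ (s + k) ⊖ (i + i + L)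
    lower i = trans (rearrange (+ s) (+ i) (+ L) (+ k)) ([+m]-[+n]≡m⊖n (s + k) (i + i + L))
      where
      rearrange : ∀ S I L K → (((+ 1 Int.+ S) - (I Int.+ (I Int.+ + 0))) - L Int.+ K) - + 1 ≡ (S Int.+ K) - (I Int.+ I Int.+ L)
      rearrange = ZR.solve-∀

  δℤ : ℤ → ℕ → ℕ
  δℤ (+ t) ℓ = δ ℓ t
  δℤ -[1+ _ ] ℓ = 0

  δℤ-⊖ : ∀ x s ℓ → δℤ (x ⊖ s) ℓ ≡ δ x (ℓ + s)
  δℤ-⊖ x s ℓ with s ≤? x
  ... | yes s≤x rewrite ⊖-≥ s≤x with ℓ ≟ x ∸ s
  ...   | yes ℓ≡x∸s = trans (δ-≡ ℓ≡x∸s) (sym (δ-≡ (trans (sym (m∸n+n≡m s≤x)) (cong (_+ s) (sym ℓ≡x∸s)))))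
  ...   | no ℓ≢x∸s = trans (δ-≢ ℓ≢x∸s) (sym (δ-≢ λ x≡ℓ+s → ℓ≢x∸s (m+n≡o⇒m≡o∸n s (sym x≡ℓ+s))))
  δℤ-⊖ x s ℓ | no s≰x with ⊖-≰⇒negative s≰x
  ... | n , x⊖s≡-[1+n] rewrite x⊖s≡-[1+n] = sym (δ-≢ λ x≡ℓ+s → s≰x (subst (s ≤_) (sym x≡ℓ+s) (m≤n+m s ℓ)))

  δℤ-subst : ∀ (f : ℤ → ℕ) t ℓ → f t * δℤ t ℓ ≡ f (+ ℓ) * δℤ t ℓ
  δℤ-subst f (+ t) ℓ with ℓ ≟ t
  ... | yes refl = refl
  ... | no ℓ≢t rewrite δ-≢ ℓ≢t = trans (*-zeroʳ (f (+ t))) (sym (*-zeroʳ (f (+ ℓ))))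
  δℤ-subst f -[1+ n ] ℓ = trans (*-zeroʳ (f -[1+ n ])) (sym (*-zeroʳ (f (+ ℓ))))

  windowIndex : ℕ → ℕ → ℕ → ℤ
  windowIndex k s j = (+ k - + s) Int.+ + j

  windowIndex≡⊖ : ∀ k s j → windowIndex k s j ≡ (k + j) ⊖ s
  windowIndex≡⊖ k s j = trans (reassociate (+ k) (+ s) (+ j)) ([+m]-[+n]≡m⊖n (k + j) s)
    where
    reassociate : ∀ K S J → (K - S) Int.+ J ≡ (K Int.+ J) - S
    reassociate = ZR.solve-∀

  coef-window : ∀ s m P ℓ k → P + ℓ ≡ suc s * m →
    Σ< (2 * suc s ∸ 1) (λ j → coef (suc s) (suc m) k (windowIndex k s j) * δℤ (windowIndex k s j) ℓ) ≡ tripleSum s P ℓ k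
  coef-window s m P ℓ k P+ℓ≡ = begin
    Σ< (2 * suc s ∸ 1) (λ j → c (t j) * δℤ (t j) ℓ)
      ≡⟨ ∑-cong (upTo (2 * suc s ∸ 1)) (λ j → trans (δℤ-subst c (t j) ℓ)
                                                  (cong (c (+ ℓ) *_) (trans (cong (λ t → δℤ t ℓ) (windowIndex≡⊖ k s j)) (δℤ-⊖ (k + j) s ℓ)))) ⟩
    Σ< (2 * suc s ∸ 1) (λ j → c (+ ℓ) * δ (k + j) (ℓ + s))
      ≡⟨ ∑-*ˡ (upTo (2 * suc s ∸ 1)) (c (+ ℓ)) _ ⟩
    c (+ ℓ) * Σ< (2 * suc s ∸ 1) (λ j → δ (k + j) (ℓ + s))
      ≡⟨ cong₂ _*_ (coef≡tripleSum s m P ℓ k P+ℓ≡) (cong (λ N → Σ< N (λ j → δ (k + j) (ℓ + s))) (2[1+s]∸1≡1+s+s s)) ⟩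
    tripleSum s P ℓ k * Σ< (suc (s + s)) (λ j → δ (k + j) (ℓ + s))
      ≡⟨ tripleSum-window s P ℓ k ⟩
    tripleSum s P ℓ k
      ∎
    where
    c : ℤ → ℕ
    c = coef (suc s) (suc m) k
    t : ℕ → ℤ
    t = windowIndex k s
    2[1+s]∸1≡1+s+s : ∀ s → 2 * suc s ∸ 1 ≡ suc (s + s)
    2[1+s]∸1≡1+s+s s = trans (+-suc s (s + 0)) (cong (λ x → suc (s + x)) (+-identityʳ s))

  aZ-as-∑ : ∀ d m t → aZ d (+ m) t ≡ ∑ (allWords m (m * d)) (λ w → 𝟙 (isDiagram m d w) * δℤ t (loops w))
  aZ-as-∑ d m (+ t) = trans (length-filterᵇ _ (allWords m (m * d))) (∑-cong (allWords m (m * d)) λ w → 𝟙-∧ (isDiagram m d w) _)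
  aZ-as-∑ d m -[1+ _ ] = sym (∑-zero (allWords m (m * d)) λ w → *-zeroʳ (𝟙 (isDiagram m d w)))

  rhs-as-∑ : ∀ s m k →
    rhs (suc s) (suc m) k ≡ ∑ (allWords m (m * suc s)) (λ w → 𝟙 (isDiagram m (suc s) w) * tripleSum s (openGaps w) (loops w) k)
  rhs-as-∑ s m k = begin
    Σ< N (λ j → c (t j) * aZ d (+ m) (t j))
      ≡⟨ ∑-cong (upTo N) (λ j → trans (cong (c (t j) *_) (aZ-as-∑ d m (t j))) (sym (∑-*ˡ W (c (t j)) _))) ⟩
    Σ< N (λ j → ∑ W (λ w → c (t j) * (𝟙 (D w) * δℤ (t j) (loops w))))
      ≡⟨ ∑-comm (upTo N) W _ ⟩
    ∑ W (λ w → Σ< N (λ j → c (t j) * (𝟙 (D w) * δℤ (t j) (loops w))))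
      ≡⟨ ∑-cong W (λ w → trans (∑-cong (upTo N) λ j → *-left-comm (c (t j)) (𝟙 (D w)) (δℤ (t j) (loops w)))
                               (∑-*ˡ (upTo N) (𝟙 (D w)) λ j → c (t j) * δℤ (t j) (loops w))) ⟩
    ∑ W (λ w → 𝟙 (D w) * Σ< N (λ j → c (t j) * δℤ (t j) (loops w)))
      ≡⟨ ∑-cong-All (allWords-length m (m * d)) (λ w lw → cong (𝟙 (D w) *_) (coef-window s m (openGaps w) (loops w) k (P+L≡ w lw))) ⟩
    ∑ W (λ w → 𝟙 (D w) * tripleSum s (openGaps w) (loops w) k)
      ∎
    where
    d N : ℕ
    d = suc s
    N = 2 * d ∸ 1
    W : List (List (Fin m))
    W = allWords m (m * d)
    D : List (Fin m) → Bool
    D = isDiagram m d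
    c : ℤ → ℕ
    c = coef d (suc m) k
    t : ℕ → ℤ
    t = windowIndex k s
    P+L≡ : ∀ w → length w ≡ m * d → openGaps w + loops w ≡ d * m
    P+L≡ w lw = trans (openGaps+loops≡length w) (trans lw (*-comm m d))

mainTheorem2 : (d : ℕ) → 2 ≤ d → (n : ℕ) → 0 < n → (k : ℕ) → k ≤ n * (d ∸ 1) →
    aN d n k ≡ rhs d n k
mainTheorem2 (suc s) _ (suc m) _ k _ = trans (aN-by-first-block s m k) (sym (rhs-as-∑ s m k))
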